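{- Let $L\ge2$ and $r\ge0$ be integers and $\kappa,\omega$ complex numbers. Let $Z_{2r}(\kappa,\omega;L)$ be the weight polynomial of Dyck paths of length $2r$ from height $0$ to height $0$ in the strip of height $L$, where down steps starting at height $1$ have weight $\kappa$, down steps starting at height $L$ have weight $\omega$, and all other steps have weight $1$. Put $\hat\kappa=\kappa-1$, $\hat\omega=\omega-1$ and $$A=\rho^2-\hat\omega,\quad B=1-\hat\omega\rho^2,\quad C=\rho^2-\hat\kappa,\quad D=1-\hat\kappa\rho^2.$$ Then $$Z_{2r}(\kappa,\omega;L)=\mathrm{CT}_\rho\left[(\rho+\rho^{ -1})^{2r}(1-\rho^2)\frac{A\rho^L-B\rho^{ -L}}{AC\rho^L-BD\rho^{ -L}}\right].$$
   Context: A Dyck path of length $n$ in the strip of height $L$ is a sequence $v_0\dots v_n$ of points in $\mathbb{Z}_{\ge0}\times\{0,\dots,L\}$ with $v_i-v_{i-1}\in\{(1,1),(1,-1)\}$; a step is weighted according to the height of its left endpoint, the weight of a path is the product of its step weights, and the weight polynomial is the sum of the weights of all paths of the given length, start and end height. Constant term: for a rational function $f(\rho)$, $\mathrm{CT}_\rho[f]$ is the coefficient of $\rho^0$ in the Laurent expansion $\sum_{n\ge n_0}a_n\rho^n$ ($n_0\in\mathbb{Z}$) of $f$ about $\rho=0$ valid in a punctured disc around the origin. -}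

module Defs where

open import Algebra.Bundles using (CommutativeRing)
open import Data.Bool using (Bool; true; false; if_then_else_)
open import Data.Nat as ℕ using (ℕ; zero; suc; _⊔_; _∸_; _≡ᵇ_; _<ᵇ_; _≤ᵇ_)
open import Data.List using (List; []; _∷_; map; _++_; replicate; zipWith; foldr; drop)
open import Data.Product using (_×_; _,_; proj₁; proj₂)

data Step : Set where
  up down : Step

allSeqs : ℕ → List (List Step)
allSeqs zero = [] ∷ []
allSeqs (suc n) = map (up ∷_) (allSeqs n) ++ map (down ∷_) (allSeqs n)

isPath : ℕ → ℕ → List Step → ℕ → Bool
isPath L h [] h' = h ≡ᵇ h'
isPath L h (up ∷ s) h' = if h <ᵇ L then isPath L (suc h) s h' else false
isPath L zero (down ∷ s) h' = false
isPath L (suc h) (down ∷ s) h' = isPath L h s h'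

module WithRing {c ℓ} (R : CommutativeRing c ℓ) where
  open CommutativeRing R

  stepW : Carrier → Carrier → ℕ → ℕ → Step → Carrier
  stepW κ ω L h up = 1#
  stepW κ ω L h down = if h ≡ᵇ 1 then κ else (if h ≡ᵇ L then ω else 1#)

  pathW : Carrier → Carrier → ℕ → ℕ → List Step → Carrier
  pathW κ ω L h [] = 1#
  pathW κ ω L h (up ∷ s) = stepW κ ω L h up * pathW κ ω L (suc h) s
  pathW κ ω L h (down ∷ s) = stepW κ ω L h down * pathW κ ω L (h ∸ 1) s

  sumR : List Carrier → Carrier
  sumR = foldr _+_ 0#

  Z : Carrier → Carrier → ℕ → ℕ → Carrier
  Z κ ω L n = sumR (map (λ s → if isPath L 0 s 0 then pathW κ ω L 0 s else 0#) (allSeqs n))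

  -- Polynomials (coefficient lists, index i = coefficient of ρ^i)

  padd : List Carrier → List Carrier → List Carrier
  padd [] q = q
  padd (a ∷ p) [] = a ∷ p
  padd (a ∷ p) (b ∷ q) = (a + b) ∷ padd p q

  pmul : List Carrier → List Carrier → List Carrier
  pmul [] q = []
  pmul (a ∷ p) q = padd (map (a *_) q) (0# ∷ pmul p q)

  shiftUp : ℕ → List Carrier → List Carrier
  shiftUp k p = replicate k 0# ++ p

  -- Laurent polynomials: (m , p) represents ρ^(-m) · p(ρ)

  Laurent : Set c
  Laurent = ℕ × List Carrier

  ladd : Laurent → Laurent → Laurent
  ladd (m , p) (n , q) = (m ⊔ n , padd (shiftUp ((m ⊔ n) ∸ m) p) (shiftUp ((m ⊔ n) ∸ n) q))

  lneg : Laurent → Laurent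
  lneg (m , p) = (m , map -_ p)

  lsub : Laurent → Laurent → Laurent
  lsub x y = ladd x (lneg y)

  lmul : Laurent → Laurent → Laurent
  lmul (m , p) (n , q) = (m ℕ.+ n , pmul p q)

  lconst : Carrier → Laurent
  lconst a = (0 , a ∷ [])

  lρ : Laurent
  lρ = (0 , 0# ∷ 1# ∷ [])

  lρ⁻¹ : Laurent
  lρ⁻¹ = (1 , 1# ∷ [])

  lpow : Laurent → ℕ → Laurent
  lpow x zero = lconst 1#
  lpow x (suc n) = lmul x (lpow x n)

  -- Constant term of a quotient N / D of Laurent polynomials, D = ρ^(-k) q(ρ)
  -- with q(0) a unit with inverse u.  Then N/D = ρ^(k-m) p(ρ) q(ρ)⁻¹ where
  -- q⁻¹ is the power series inverse; this is the Laurent expansion at 0.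

  lowest : Laurent → Carrier
  lowest (k , []) = 0#
  lowest (k , a ∷ q) = a

  dot : List Carrier → List Carrier → Carrier
  dot p q = sumR (zipWith _*_ p q)

  -- invRev q u n = (c_n , … , c_0), the first coefficients of 1/q(ρ),
  -- where u is the inverse of q(0):  c_0 = u,
  -- c_(n+1) = - u · (q_1 c_n + … + q_(n+1) c_0).
  invRev : List Carrier → Carrier → ℕ → List Carrier
  invRev q u zero = u ∷ []
  invRev q u (suc n) = (- (u * dot (drop 1 q) (invRev q u n))) ∷ invRev q u n

  quotCoeff : List Carrier → List Carrier → Carrier → ℕ → Carrier
  quotCoeff p q u n = dot p (invRev q u n)

  CT : Laurent → Laurent → Carrier → Carrier
  CT (m , p) (k , q) u = if k ≤ᵇ m then quotCoeff p q u (m ∸ k) else 0#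

  lA lB lC lD : Carrier → Laurent
  lA ω = lsub (lpow lρ 2) (lconst (ω - 1#))
  lB ω = lsub (lconst 1#) (lmul (lconst (ω - 1#)) (lpow lρ 2))
  lC κ = lsub (lpow lρ 2) (lconst (κ - 1#))
  lD κ = lsub (lconst 1#) (lmul (lconst (κ - 1#)) (lpow lρ 2))

  Num : Carrier → Carrier → ℕ → ℕ → Laurent
  Num κ ω L r =
    lmul (lmul (lpow (ladd lρ lρ⁻¹) (r ℕ.+ r)) (lsub (lconst 1#) (lpow lρ 2)))
         (lsub (lmul (lA ω) (lpow lρ L)) (lmul (lB ω) (lpow lρ⁻¹ L)))

  Den : Carrier → Carrier → ℕ → Laurent
  Den κ ω L =
    lsub (lmul (lmul (lA ω) (lC κ)) (lpow lρ L))
         (lmul (lmul (lB ω) (lD κ)) (lpow lρ⁻¹ L))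

module Submission where

-- Multiplying numerator and denominator by powers of ρ turns the rational function into
-- Y^(2r) N / Q with the power series Y = 1 + ρ², N = (1 - ρ²)(A ρ^(2L) - B) and
-- Q = A C ρ^(2L) - B D, and its constant term into the coefficient of ρ^(2r) in Y^(2r) G,
-- where G = N / Q exists because Q(0) = -1.  Put P₀ = 1, P₁ = Y and
-- P_(h+2) = Y P_(h+1) - w_h ρ² P_h, with w₀ = κ and w_h = 1 otherwise.  Then
-- Ψ(n, h) = [ρ^(n+h)] Y^n P_h G obeys the recursion of the weight of paths of length n from
-- height h to 0: multiplying by Y splits off an up step (P_(h+1)) and a down step
-- (w_(h-1) ρ² P_(h-1), where ρ² absorbs the shift of the index).  At the top,
-- Y P_L = T + ω ρ² P_(L-1) with T G = -(A ρ^(2L) - B), whose contribution vanishes because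
-- Y^n is a palindrome.  The initial values Ψ(0, h) = [h = 0] follow from the closed form
-- (ρ² - 1) P_(h+1) = C ρ^(2h+2) - D, which gives P_h G ≡ 1 modulo ρ^(2h).

open import Defs
open import Algebra.Bundles using (CommutativeRing)
import Algebra.Construct.Pointwise as Pointwise
import Algebra.Solver.Ring.AlmostCommutativeRing as ACR
open import Data.Bool using (true; false; if_then_else_)
open import Data.Integer as ℤ using (ℤ; +_; -[1+_])
import Data.Integer.Properties as ℤ
open import Data.List using (List; []; _∷_; map; _++_; drop)
import Data.List.Properties as List
open import Data.Maybe using (Maybe; just; nothing)
open import Data.Nat as ℕ using (ℕ; zero; suc; _<_; _≤_; _⊔_; _∸_; _≡ᵇ_; _<ᵇ_; _≤ᵇ_; s≤s; z≤n; z<s)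
import Data.Nat.Properties as ℕ
open import Data.Product using (_×_; _,_; proj₁; proj₂; ∃-syntax)
open import Data.Sign as Sign using (Sign)
open import Data.Sum using (inj₁; inj₂)
open import Data.Unit using (tt)
open import Relation.Nullary using (yes; no; contradiction)
open import Relation.Binary.PropositionalEquality as ≡ using (_≡_)
import Relation.Binary.Reasoning.Setoid as SetoidReasoning

module IntegerCoefficients {c ℓ} (R : CommutativeRing c ℓ) where

  open CommutativeRing R
  open import Algebra.Properties.Ring ring using (-‿involutive; -0#≈0#; -‿distribˡ-*; -‿distribʳ-*)
  open import Algebra.Properties.AbelianGroup +-abelianGroup using (⁻¹-∙-comm)
  open import Algebra.Properties.CommutativeSemigroup +-commutativeSemigroup using (interchange)
  open import Algebra.Properties.Semiring.Mult.TCOptimised semiring using (1+×; ×-homo-+; ×1-homo-*) renaming (_×_ to _×′_)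
  open SetoidReasoning setoid

  -- The solver needs coefficients with decidable equality, hence ℤ.  The optimised multiple
  -- makes the constants 0 and 1 denote 0# and 1# definitionally.
  fromℤ : ℤ → Carrier
  fromℤ (+ n) = n ×′ 1#
  fromℤ -[1+ n ] = - (suc n ×′ 1#)

  fromℤ-neg : ∀ i → fromℤ (ℤ.- i) ≈ - fromℤ i
  fromℤ-neg -[1+ n ] = sym (-‿involutive _)
  fromℤ-neg (+ zero) = sym -0#≈0#
  fromℤ-neg (+ suc n) = refl

  fromℤ-⊖ : ∀ m n → fromℤ (m ℤ.⊖ n) ≈ m ×′ 1# - n ×′ 1#
  fromℤ-⊖ m zero = sym (trans (+-congˡ -0#≈0#) (+-identityʳ _))
  fromℤ-⊖ zero (suc n) = sym (+-identityˡ _)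
  fromℤ-⊖ (suc m) (suc n) rewrite ℤ.[1+m]⊖[1+n]≡m⊖n m n = begin
    fromℤ (m ℤ.⊖ n)                            ≈⟨ fromℤ-⊖ m n ⟩
    m ×′ 1# - n ×′ 1#                          ≈⟨ +-identityˡ _ ⟨
    0# + (m ×′ 1# - n ×′ 1#)                   ≈⟨ +-congʳ (-‿inverseʳ 1#) ⟨
    (1# - 1#) + (m ×′ 1# - n ×′ 1#)            ≈⟨ interchange _ _ _ _ ⟩
    (1# + m ×′ 1#) + (- 1# - n ×′ 1#)          ≈⟨ +-cong (1+× m 1#) (trans (-‿cong (1+× n 1#)) (sym (⁻¹-∙-comm _ _))) ⟨
    suc m ×′ 1# - suc n ×′ 1#                  ∎

  fromℤ-+ : ∀ i j → fromℤ (i ℤ.+ j) ≈ fromℤ i + fromℤ j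
  fromℤ-+ -[1+ m ] -[1+ n ] = begin
    - (suc (suc (m ℕ.+ n)) ×′ 1#)      ≡⟨ ≡.cong (λ k → - (k ×′ 1#)) (ℕ.+-suc (suc m) n) ⟨
    - ((suc m ℕ.+ suc n) ×′ 1#)        ≈⟨ -‿cong (×-homo-+ 1# (suc m) (suc n)) ⟩
    - (suc m ×′ 1# + suc n ×′ 1#)       ≈⟨ ⁻¹-∙-comm _ _ ⟨
    - (suc m ×′ 1#) - (suc n ×′ 1#)     ∎
  fromℤ-+ -[1+ m ] (+ n) = trans (fromℤ-⊖ n (suc m)) (+-comm _ _)
  fromℤ-+ (+ m) -[1+ n ] = fromℤ-⊖ m (suc n)
  fromℤ-+ (+ m) (+ n) = ×-homo-+ 1# m n

  private
    signed : Sign → Carrier → Carrier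
    signed Sign.+ x = x
    signed Sign.- x = - x

    signed-cong : ∀ s {x y} → x ≈ y → signed s x ≈ signed s y
    signed-cong Sign.+ x≈y = x≈y
    signed-cong Sign.- x≈y = -‿cong x≈y

    fromℤ-◃ : ∀ s n → fromℤ (s ℤ.◃ n) ≈ signed s (n ×′ 1#)
    fromℤ-◃ Sign.+ zero = refl
    fromℤ-◃ Sign.+ (suc n) = refl
    fromℤ-◃ Sign.- zero = sym -0#≈0#
    fromℤ-◃ Sign.- (suc n) = refl

    signed-* : ∀ s t x y → signed (s Sign.* t) (x * y) ≈ signed s x * signed t y
    signed-* Sign.+ Sign.+ x y = refl
    signed-* Sign.+ Sign.- x y = -‿distribʳ-* x y
    signed-* Sign.- Sign.+ x y = -‿distribˡ-* x y
    signed-* Sign.- Sign.- x y = begin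
      x * y           ≈⟨ -‿involutive _ ⟨
      - - (x * y)     ≈⟨ -‿cong (-‿distribʳ-* x y) ⟩
      - (x * - y)     ≈⟨ -‿distribˡ-* x (- y) ⟩
      - x * - y       ∎

    fromℤ-signAbs : ∀ i → fromℤ i ≈ signed (ℤ.sign i) (ℤ.∣ i ∣ ×′ 1#)
    fromℤ-signAbs (+ n) = refl
    fromℤ-signAbs -[1+ n ] = refl

  fromℤ-* : ∀ i j → fromℤ (i ℤ.* j) ≈ fromℤ i * fromℤ j
  fromℤ-* i j = begin
    fromℤ (i ℤ.* j)                                  ≈⟨ fromℤ-◃ (s Sign.* t) (ℤ.∣ i ∣ ℕ.* ℤ.∣ j ∣) ⟩
    signed (s Sign.* t) ((ℤ.∣ i ∣ ℕ.* ℤ.∣ j ∣) ×′ 1#) ≈⟨ signed-cong (s Sign.* t) (×1-homo-* ℤ.∣ i ∣ ℤ.∣ j ∣) ⟩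
    signed (s Sign.* t) (ℤ.∣ i ∣ ×′ 1# * ℤ.∣ j ∣ ×′ 1#) ≈⟨ signed-* s t _ _ ⟩
    signed s (ℤ.∣ i ∣ ×′ 1#) * signed t (ℤ.∣ j ∣ ×′ 1#) ≈⟨ *-cong (fromℤ-signAbs i) (fromℤ-signAbs j) ⟨
    fromℤ i * fromℤ j                                ∎
    where
    s = ℤ.sign i
    t = ℤ.sign j

  fromℤ-homomorphism : ACR._-Raw-AlmostCommutative⟶_ ℤ.+-*-rawRing (ACR.fromCommutativeRing R)
  fromℤ-homomorphism = record
    { ⟦_⟧ = fromℤ ; +-homo = fromℤ-+ ; *-homo = fromℤ-* ; -‿homo = fromℤ-neg
    ; 0-homo = refl ; 1-homo = refl }

  fromℤ-≟ : ∀ i j → Maybe (fromℤ i ≈ fromℤ j)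
  fromℤ-≟ i j with i ℤ.≟ j
  ... | yes ≡.refl = just refl
  ... | no _ = nothing

  open import Algebra.Solver.Ring ℤ.+-*-rawRing (ACR.fromCommutativeRing R) fromℤ-homomorphism fromℤ-≟ public

  :0 :1 : ∀ {n} → Polynomial n
  :0 = con (+ 0)
  :1 = con (+ 1)

module PowerSeries {c ℓ} (R : CommutativeRing c ℓ) where

  open CommutativeRing R
  open import Algebra.Properties.CommutativeSemigroup +-commutativeSemigroup using (interchange; x∙yz≈y∙xz)
  open SetoidReasoning setoid

  Series : Set c
  Series = ℕ → Carrier

  infix 4 _≋_
  infixl 6 _⊕_ _⊖_
  infixl 7 _⊛_ _·_

  _≋_ : Series → Series → Set ℓ
  a ≋ b = ∀ i → a i ≈ b i

  _⊕_ : Series → Series → Series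
  (a ⊕ b) i = a i + b i

  ⊝ : Series → Series
  ⊝ a i = - a i

  _⊖_ : Series → Series → Series
  a ⊖ b = a ⊕ ⊝ b

  𝟘 : Series
  𝟘 _ = 0#

  𝟙 : Series
  𝟙 zero = 1#
  𝟙 (suc _) = 0#

  _⊛_ : Series → Series → Series
  (a ⊛ b) zero = a 0 * b 0
  (a ⊛ b) (suc n) = a 0 * b (suc n) + ((λ i → a (suc i)) ⊛ b) n

  _·_ : Carrier → Series → Series
  (k · a) i = k * a i

  shift : Series → Series
  shift a zero = 0#
  shift a (suc i) = a i

  ⊛-cong : ∀ {a a′ b b′} → a ≋ a′ → b ≋ b′ → a ⊛ b ≋ a′ ⊛ b′
  ⊛-cong a≋a′ b≋b′ zero = *-cong (a≋a′ 0) (b≋b′ 0)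
  ⊛-cong a≋a′ b≋b′ (suc n) = +-cong (*-cong (a≋a′ 0) (b≋b′ (suc n))) (⊛-cong (λ i → a≋a′ (suc i)) b≋b′ n)

  ⊛-distribʳ : ∀ a a′ b → (a ⊕ a′) ⊛ b ≋ a ⊛ b ⊕ a′ ⊛ b
  ⊛-distribʳ a a′ b zero = distribʳ _ _ _
  ⊛-distribʳ a a′ b (suc n) =
    trans (+-cong (distribʳ _ _ _) (⊛-distribʳ (λ i → a (suc i)) (λ i → a′ (suc i)) b n)) (interchange _ _ _ _)

  ⊛-distribˡ : ∀ a b b′ → a ⊛ (b ⊕ b′) ≋ a ⊛ b ⊕ a ⊛ b′
  ⊛-distribˡ a b b′ zero = distribˡ _ _ _
  ⊛-distribˡ a b b′ (suc n) =
    trans (+-cong (distribˡ _ _ _) (⊛-distribˡ (λ i → a (suc i)) b b′ n)) (interchange _ _ _ _)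

  ⊛-zeroˡ : ∀ b → 𝟘 ⊛ b ≋ 𝟘
  ⊛-zeroˡ b zero = zeroˡ _
  ⊛-zeroˡ b (suc n) = trans (+-cong (zeroˡ _) (⊛-zeroˡ b n)) (+-identityʳ _)

  ·-⊛ : ∀ k a b → k · a ⊛ b ≋ k · (a ⊛ b)
  ·-⊛ k a b zero = *-assoc _ _ _
  ·-⊛ k a b (suc n) = trans (+-cong (*-assoc _ _ _) (·-⊛ k (λ i → a (suc i)) b n)) (sym (distribˡ _ _ _))

  ⊛-identityˡ : ∀ b → 𝟙 ⊛ b ≋ b
  ⊛-identityˡ b zero = *-identityˡ _
  ⊛-identityˡ b (suc n) = trans (+-cong (*-identityˡ _) (⊛-zeroˡ b n)) (+-identityʳ _)

  shift-⊛ : ∀ a b n → (shift a ⊛ b) (suc n) ≈ (a ⊛ b) n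
  shift-⊛ a b n = trans (+-congʳ (zeroˡ _)) (+-identityˡ _)

  ⊛-unfoldˡ : ∀ a b → a ⊛ b ≋ a 0 · b ⊕ shift ((λ i → a (suc i)) ⊛ b)
  ⊛-unfoldˡ a b zero = sym (+-identityʳ _)
  ⊛-unfoldˡ a b (suc n) = refl

  ⊛-comm : ∀ a b → a ⊛ b ≋ b ⊛ a
  ⊛-comm a b zero = *-comm _ _
  ⊛-comm a b (suc zero) = trans (+-cong (*-comm _ _) (*-comm _ _)) (+-comm _ _)
  ⊛-comm a b (suc (suc n)) = begin
    a 0 * b (2 ℕ.+ n) + (a′ ⊛ b) (suc n)                  ≈⟨ +-congˡ (⊛-comm a′ b (suc n)) ⟩
    a 0 * b (2 ℕ.+ n) + (b 0 * a′ (suc n) + (b′ ⊛ a′) n)  ≈⟨ x∙yz≈y∙xz _ _ _ ⟩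
    b 0 * a (2 ℕ.+ n) + (a 0 * b (2 ℕ.+ n) + (b′ ⊛ a′) n) ≈⟨ +-congˡ (+-congˡ (⊛-comm b′ a′ n)) ⟩
    b 0 * a (2 ℕ.+ n) + (a 0 * b′ (suc n) + (a′ ⊛ b′) n)  ≈⟨ +-congˡ (⊛-comm a b′ (suc n)) ⟩
    b 0 * a (2 ℕ.+ n) + (b′ ⊛ a) (suc n)                  ∎
    where
    a′ b′ : Series
    a′ i = a (suc i)
    b′ i = b (suc i)

  ⊛-assoc : ∀ a b d → (a ⊛ b) ⊛ d ≋ a ⊛ (b ⊛ d)
  ⊛-assoc a b d zero = *-assoc _ _ _
  ⊛-assoc a b d (suc n) = begin
    ((a ⊛ b) ⊛ d) (suc n)                                 ≈⟨ ⊛-cong (⊛-unfoldˡ a b) (λ _ → refl) (suc n) ⟩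
    ((a 0 · b ⊕ shift (a′ ⊛ b)) ⊛ d) (suc n)              ≈⟨ ⊛-distribʳ (a 0 · b) (shift (a′ ⊛ b)) d (suc n) ⟩
    (a 0 · b ⊛ d) (suc n) + (shift (a′ ⊛ b) ⊛ d) (suc n)  ≈⟨ +-cong (·-⊛ (a 0) b d (suc n)) (shift-⊛ (a′ ⊛ b) d n) ⟩
    a 0 * (b ⊛ d) (suc n) + ((a′ ⊛ b) ⊛ d) n              ≈⟨ +-congˡ (⊛-assoc a′ b d n) ⟩
    a 0 * (b ⊛ d) (suc n) + (a′ ⊛ (b ⊛ d)) n              ∎
    where
    a′ : Series
    a′ i = a (suc i)

  powerSeriesRing : CommutativeRing c ℓ
  powerSeriesRing = record
    { Carrier = Series ; _≈_ = _≋_ ; _+_ = _⊕_ ; _*_ = _⊛_ ; -_ = ⊝ ; 0# = 𝟘 ; 1# = 𝟙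
    ; isCommutativeRing = record
      { isRing = record
        { +-isAbelianGroup = Pointwise.isAbelianGroup ℕ +-isAbelianGroup
        ; *-cong = ⊛-cong
        ; *-assoc = ⊛-assoc
        ; *-identity = ⊛-identityˡ , λ a n → trans (⊛-comm a 𝟙 n) (⊛-identityˡ a n)
        ; distrib = ⊛-distribˡ , λ a b b′ → ⊛-distribʳ b b′ a }
      ; *-comm = ⊛-comm } }

  X : Series
  X = shift 𝟙

  X⊛≋shift : ∀ a → X ⊛ a ≋ shift a
  X⊛≋shift a zero = zeroˡ _
  X⊛≋shift a (suc i) = trans (shift-⊛ 𝟙 a i) (⊛-identityˡ a i)

  const : Carrier → Series
  const a zero = a
  const a (suc _) = 0#

  const-cong : ∀ {a b} → a ≈ b → const a ≋ const b
  const-cong a≈b zero = a≈b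
  const-cong a≈b (suc i) = refl

  const-⊛ : ∀ a b → const a ⊛ b ≋ a · b
  const-⊛ a b zero = refl
  const-⊛ a b (suc n) = trans (+-congˡ (⊛-zeroˡ b n)) (+-identityʳ _)

  const-1# : const 1# ≋ 𝟙
  const-1# zero = refl
  const-1# (suc i) = refl

  const-+ : ∀ a b → const (a + b) ≋ const a ⊕ const b
  const-+ a b zero = refl
  const-+ a b (suc i) = sym (+-identityʳ 0#)

  reindex : ∀ (a : Series) {i j} → i ≡ j → a i ≈ a j
  reindex a ≡.refl = refl

  private module S = CommutativeRing powerSeriesRing
  open import Algebra.Properties.Semiring.Exp S.semiring public using (_^_; ^-homo-*)

  ⊛-X⊛-suc : ∀ e v i → (e ⊛ (X ⊛ v)) (suc i) ≈ (e ⊛ v) i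
  ⊛-X⊛-suc e v i = begin
    (e ⊛ (X ⊛ v)) (suc i) ≈⟨ ⊛-assoc e X v (suc i) ⟨
    (e ⊛ X ⊛ v) (suc i)   ≈⟨ ⊛-cong (⊛-comm e X) S.refl (suc i) ⟩
    (X ⊛ e ⊛ v) (suc i)   ≈⟨ ⊛-assoc X e v (suc i) ⟩
    (X ⊛ (e ⊛ v)) (suc i) ≈⟨ X⊛≋shift (e ⊛ v) (suc i) ⟩
    (e ⊛ v) i             ∎

  ⊛-X^⊛-+ : ∀ e k v i → (e ⊛ (X ^ k ⊛ v)) (k ℕ.+ i) ≈ (e ⊛ v) i
  ⊛-X^⊛-+ e zero v i = ⊛-cong {e} S.refl (⊛-identityˡ v) i
  ⊛-X^⊛-+ e (suc k) v i = begin
    (e ⊛ (X ⊛ X ^ k ⊛ v)) (suc k ℕ.+ i) ≈⟨ ⊛-cong {e} S.refl (⊛-assoc X (X ^ k) v) (suc (k ℕ.+ i)) ⟩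
    (e ⊛ (X ⊛ (X ^ k ⊛ v))) (suc (k ℕ.+ i)) ≈⟨ ⊛-X⊛-suc e (X ^ k ⊛ v) (k ℕ.+ i) ⟩
    (e ⊛ (X ^ k ⊛ v)) (k ℕ.+ i) ≈⟨ ⊛-X^⊛-+ e k v i ⟩
    (e ⊛ v) i ∎

  X^-symmetric : ∀ a b → (X ^ a) b ≈ (X ^ b) a
  X^-symmetric zero zero = refl
  X^-symmetric zero (suc b) = sym (X⊛≋shift (X ^ b) 0)
  X^-symmetric (suc a) zero = X⊛≋shift (X ^ a) 0
  X^-symmetric (suc a) (suc b) = begin
    (X ⊛ X ^ a) (suc b) ≈⟨ X⊛≋shift (X ^ a) (suc b) ⟩
    (X ^ a) b           ≈⟨ X^-symmetric a b ⟩
    (X ^ b) a           ≈⟨ X⊛≋shift (X ^ b) (suc a) ⟨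
    (X ⊛ X ^ b) (suc a) ∎

module LaurentExpansion {c ℓ} (R : CommutativeRing c ℓ) where

  open CommutativeRing R
  open WithRing R
  open PowerSeries R
  private module S = CommutativeRing powerSeriesRing
  open import Algebra.Properties.Ring ring using (-0#≈0#; -‿distribʳ-*)
  open SetoidReasoning setoid

  coeff : List Carrier → Series
  coeff [] _ = 0#
  coeff (a ∷ p) zero = a
  coeff (a ∷ p) (suc i) = coeff p i

  coeff-padd : ∀ p q → coeff (padd p q) ≋ coeff p ⊕ coeff q
  coeff-padd [] q i = sym (+-identityˡ _)
  coeff-padd (a ∷ p) [] i = sym (+-identityʳ _)
  coeff-padd (a ∷ p) (b ∷ q) zero = refl
  coeff-padd (a ∷ p) (b ∷ q) (suc i) = coeff-padd p q i

  coeff-map-* : ∀ a q → coeff (map (a *_) q) ≋ a · coeff q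
  coeff-map-* a [] i = sym (zeroʳ _)
  coeff-map-* a (b ∷ q) zero = refl
  coeff-map-* a (b ∷ q) (suc i) = coeff-map-* a q i

  coeff-map-neg : ∀ q → coeff (map -_ q) ≋ ⊝ (coeff q)
  coeff-map-neg [] i = sym -0#≈0#
  coeff-map-neg (b ∷ q) zero = refl
  coeff-map-neg (b ∷ q) (suc i) = coeff-map-neg q i

  coeff-0∷ : ∀ p → coeff (0# ∷ p) ≋ X ⊛ coeff p
  coeff-0∷ p i = sym (trans (X⊛≋shift (coeff p) i) (shift-coeff i))
    where
    shift-coeff : shift (coeff p) ≋ coeff (0# ∷ p)
    shift-coeff zero = refl
    shift-coeff (suc i) = refl

  coeff-pmul : ∀ p q → coeff (pmul p q) ≋ coeff p ⊛ coeff q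
  coeff-pmul [] q i = sym (⊛-zeroˡ (coeff q) i)
  coeff-pmul (a ∷ p) q i = begin
    coeff (padd (map (a *_) q) (0# ∷ pmul p q)) i   ≈⟨ coeff-padd (map (a *_) q) (0# ∷ pmul p q) i ⟩
    coeff (map (a *_) q) i + coeff (0# ∷ pmul p q) i ≈⟨ +-cong (coeff-map-* a q i) (coeff-tail i) ⟩
    (a · coeff q ⊕ shift (coeff p ⊛ coeff q)) i     ≈⟨ ⊛-unfoldˡ (coeff (a ∷ p)) (coeff q) i ⟨
    (coeff (a ∷ p) ⊛ coeff q) i                     ∎
    where
    coeff-tail : coeff (0# ∷ pmul p q) ≋ shift (coeff p ⊛ coeff q)
    coeff-tail zero = refl
    coeff-tail (suc j) = coeff-pmul p q j

  coeff-shiftUp : ∀ k p → coeff (shiftUp k p) ≋ X ^ k ⊛ coeff p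
  coeff-shiftUp zero p = S.sym (⊛-identityˡ (coeff p))
  coeff-shiftUp (suc k) p = S.trans (coeff-0∷ (shiftUp k p))
    (S.trans (S.*-congˡ (coeff-shiftUp k p)) (S.sym (S.*-assoc X (X ^ k) (coeff p))))

  -- x is the Laurent series ρ^(-m) s.
  record Represents (x : Laurent) (m : ℕ) (s : Series) : Set ℓ where
    constructor represents
    field
      offset : proj₁ x ≡ m
      coefficients : coeff (proj₂ x) ≋ s

  open Represents public

  Represents-cong : ∀ {x m m′ s s′} → m ≡ m′ → s ≋ s′ → Represents x m s → Represents x m′ s′
  Represents-cong ≡.refl s≋s′ (represents e r) = represents e (S.trans r s≋s′)

  Represents-lmul : ∀ {x y m n s t} → Represents x m s → Represents y n t →
                    Represents (lmul x y) (m ℕ.+ n) (s ⊛ t)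
  Represents-lmul {p₀ , p} {q₀ , q} (represents ≡.refl r) (represents ≡.refl r′) =
    represents ≡.refl (S.trans (coeff-pmul p q) (⊛-cong r r′))

  Represents-ladd : ∀ {x y m n s t} → Represents x m s → Represents y n t →
                    Represents (ladd x y) (m ⊔ n) (X ^ (m ⊔ n ∸ m) ⊛ s ⊕ X ^ (m ⊔ n ∸ n) ⊛ t)
  Represents-ladd {m , p} {n , q} (represents ≡.refl r) (represents ≡.refl r′) =
    represents ≡.refl (S.trans (coeff-padd (shiftUp (m ⊔ n ∸ m) p) (shiftUp (m ⊔ n ∸ n) q))
      (S.+-cong (S.trans (coeff-shiftUp (m ⊔ n ∸ m) p) (S.*-congˡ r))
                (S.trans (coeff-shiftUp (m ⊔ n ∸ n) q) (S.*-congˡ r′))))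

  Represents-lneg : ∀ {x m s} → Represents x m s → Represents (lneg x) m (⊝ s)
  Represents-lneg {m , p} (represents ≡.refl r) = represents ≡.refl (S.trans (coeff-map-neg p) (S.-‿cong r))

  Represents-lsub : ∀ {x y m n s t} → Represents x m s → Represents y n t →
                    Represents (lsub x y) (m ⊔ n) (X ^ (m ⊔ n ∸ m) ⊛ s ⊕ X ^ (m ⊔ n ∸ n) ⊛ ⊝ t)
  Represents-lsub x≈s y≈t = Represents-ladd x≈s (Represents-lneg y≈t)

  Represents-lsub-≤ : ∀ {x y m n s t} → m ≤ n → Represents x m s → Represents y n t →
                      Represents (lsub x y) n (X ^ (n ∸ m) ⊛ s ⊖ t)
  Represents-lsub-≤ {m = m} {n} {s} {t} m≤n x≈s y≈t =
    Represents-cong (ℕ.m≤n⇒m⊔n≡n m≤n) (series-≋ (ℕ.m≤n⇒m⊔n≡n m≤n)) (Represents-lsub x≈s y≈t)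
    where
    series-≋ : m ⊔ n ≡ n → X ^ (m ⊔ n ∸ m) ⊛ s ⊕ X ^ (m ⊔ n ∸ n) ⊛ ⊝ t ≋ X ^ (n ∸ m) ⊛ s ⊖ t
    series-≋ e rewrite e | ℕ.n∸n≡0 n = S.+-congˡ (⊛-identityˡ (⊝ t))

  Represents-lconst : ∀ a → Represents (lconst a) 0 (const a)
  Represents-lconst a = represents ≡.refl λ { zero → refl ; (suc i) → refl }

  Represents-lρ : Represents lρ 0 X
  Represents-lρ = represents ≡.refl λ { zero → refl ; (suc zero) → refl ; (suc (suc i)) → refl }

  Represents-lρ⁻¹ : Represents lρ⁻¹ 1 𝟙
  Represents-lρ⁻¹ = represents ≡.refl λ { zero → refl ; (suc i) → refl }

  Represents-lpow : ∀ {x m s} → Represents x m s → ∀ k → Represents (lpow x k) (k ℕ.* m) (s ^ k)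
  Represents-lpow x≈s zero = Represents-cong ≡.refl const-1# (Represents-lconst 1#)
  Represents-lpow x≈s (suc k) = Represents-lmul x≈s (Represents-lpow x≈s k)

  Represents-lρ^ : ∀ k → Represents (lpow lρ k) 0 (X ^ k)
  Represents-lρ^ k = Represents-cong (ℕ.*-zeroʳ k) S.refl (Represents-lpow Represents-lρ k)

  Represents-lρ⁻¹^ : ∀ k → Represents (lpow lρ⁻¹ k) k 𝟙
  Represents-lρ⁻¹^ zero = Represents-lpow Represents-lρ⁻¹ 0
  Represents-lρ⁻¹^ (suc k) = Represents-cong ≡.refl (⊛-identityˡ 𝟙) (Represents-lmul Represents-lρ⁻¹ (Represents-lρ⁻¹^ k))

  -- the head of invRev q u n: the n-th coefficient of 1/q when u inverts q 0
  inverse : List Carrier → Carrier → Series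
  inverse q u zero = u
  inverse q u (suc n) = - (u * dot (drop 1 q) (invRev q u n))

  dot-invRev : ∀ q u n p → dot p (invRev q u n) ≈ (coeff p ⊛ inverse q u) n
  dot-invRev q u zero [] = sym (zeroˡ _)
  dot-invRev q u zero (a ∷ []) = +-identityʳ _
  dot-invRev q u zero (a ∷ b ∷ p) = +-identityʳ _
  dot-invRev q u (suc n) [] = sym (⊛-zeroˡ (inverse q u) (suc n))
  dot-invRev q u (suc n) (a ∷ p) = +-congˡ (dot-invRev q u n p)

  coeff-drop-1 : ∀ q → coeff (drop 1 q) ≋ (λ i → coeff q (suc i))
  coeff-drop-1 [] i = refl
  coeff-drop-1 (a ∷ q) i = refl

  ⊛-inverse : ∀ q u → coeff q 0 * u ≈ 1# → coeff q ⊛ inverse q u ≋ 𝟙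
  ⊛-inverse q u q₀u≈1 zero = q₀u≈1
  ⊛-inverse q u q₀u≈1 (suc n) = begin
    q₀ * - (u * dot (drop 1 q) (invRev q u n)) + t ≈⟨ +-congʳ (*-congˡ (-‿cong (*-congˡ tail-dot))) ⟩
    q₀ * - (u * t) + t                             ≈⟨ +-congʳ (-‿distribʳ-* _ _) ⟨
    - (q₀ * (u * t)) + t                           ≈⟨ +-congʳ (-‿cong (*-assoc _ _ _)) ⟨
    - (q₀ * u * t) + t                             ≈⟨ +-congʳ (-‿cong (trans (*-congʳ q₀u≈1) (*-identityˡ t))) ⟩
    - t + t                                        ≈⟨ -‿inverseˡ t ⟩
    0#                                             ∎
    where
    q₀ = coeff q 0
    t = ((λ i → coeff q (suc i)) ⊛ inverse q u) n
    tail-dot : dot (drop 1 q) (invRev q u n) ≈ t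
    tail-dot = trans (dot-invRev q u n (drop 1 q)) (⊛-cong (coeff-drop-1 q) S.refl n)

  lowest≈coeff-0 : ∀ x → lowest x ≈ coeff (proj₂ x) 0
  lowest≈coeff-0 (k , []) = refl
  lowest≈coeff-0 (k , a ∷ q) = refl

  CT-as-coefficient : ∀ {N D k j s} u → Represents N (k ℕ.+ j) s → proj₁ D ≡ k →
                      CT N D u ≈ (s ⊛ inverse (proj₂ D) u) j
  CT-as-coefficient {_ , p} {k , q} {k} {j} u (represents ≡.refl r) ≡.refl
    with k ≤ᵇ k ℕ.+ j | ℕ.≤⇒≤ᵇ (ℕ.m≤m+n k j)
  ... | true | _ rewrite ℕ.m+n∸m≡n k j = trans (dot-invRev q u j p) (⊛-cong r S.refl j)

module PathWeights {c ℓ} (R : CommutativeRing c ℓ) (κ ω : CommutativeRing.Carrier R) (L : ℕ) where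

  open CommutativeRing R
  open WithRing R
  open SetoidReasoning setoid

  private
    sumR-++ : ∀ xs ys → sumR (xs ++ ys) ≈ sumR xs + sumR ys
    sumR-++ [] ys = sym (+-identityˡ _)
    sumR-++ (x ∷ xs) ys = trans (+-congˡ (sumR-++ xs ys)) (sym (+-assoc _ _ _))

    sumR-map-cong : ∀ {A : Set} {f g : A → Carrier} xs → (∀ a → f a ≈ g a) → sumR (map f xs) ≈ sumR (map g xs)
    sumR-map-cong [] f≈g = refl
    sumR-map-cong (x ∷ xs) f≈g = +-cong (f≈g x) (sumR-map-cong xs f≈g)

    sumR-map-* : ∀ {A : Set} a (f : A → Carrier) xs → sumR (map (λ s → a * f s) xs) ≈ a * sumR (map f xs)
    sumR-map-* a f [] = sym (zeroʳ _)
    sumR-map-* a f (x ∷ xs) = trans (+-congˡ (sumR-map-* a f xs)) (sym (distribˡ _ _ _))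

    sumR-map-0 : ∀ {A : Set} (xs : List A) → sumR (map (λ _ → 0#) xs) ≈ 0#
    sumR-map-0 [] = refl
    sumR-map-0 (x ∷ xs) = trans (+-identityˡ _) (sumR-map-0 xs)

  weightTo0 : ℕ → List Step → Carrier
  weightTo0 h s = if isPath L h s 0 then pathW κ ω L h s else 0#

  W : ℕ → ℕ → Carrier
  W n h = sumR (map (weightTo0 h) (allSeqs n))

  W-zero-zero : W 0 0 ≈ 1#
  W-zero-zero = +-identityʳ 1#

  W-zero-suc : ∀ h → W 0 (suc h) ≈ 0#
  W-zero-suc h = +-identityʳ 0#

  descend : ℕ → ℕ → Carrier
  descend n zero = 0#
  descend n (suc h) = stepW κ ω L (suc h) down * W n h

  private
    firstStep : Step → ℕ → ℕ → Carrier
    firstStep e n h = sumR (map (λ s → weightTo0 h (e ∷ s)) (allSeqs n))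

    W-suc-split : ∀ n h → W (suc n) h ≈ firstStep up n h + firstStep down n h
    W-suc-split n h = begin
      sumR (map (weightTo0 h) (map (up ∷_) S ++ map (down ∷_) S))
        ≡⟨ ≡.cong sumR (List.map-++ (weightTo0 h) (map (up ∷_) S) (map (down ∷_) S)) ⟩
      sumR (map (weightTo0 h) (map (up ∷_) S) ++ map (weightTo0 h) (map (down ∷_) S))
        ≈⟨ sumR-++ (map (weightTo0 h) (map (up ∷_) S)) _ ⟩
      sumR (map (weightTo0 h) (map (up ∷_) S)) + sumR (map (weightTo0 h) (map (down ∷_) S))
        ≡⟨ ≡.cong₂ _+_ (≡.cong sumR (≡.sym (List.map-∘ S))) (≡.cong sumR (≡.sym (List.map-∘ S))) ⟩
      firstStep up n h + firstStep down n h
        ∎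
      where
      S = allSeqs n

    firstStep-down : ∀ n h → firstStep down n h ≈ descend n h
    firstStep-down n zero = sumR-map-0 (allSeqs n)
    firstStep-down n (suc h) = trans (sumR-map-cong (allSeqs n) step) (sumR-map-* _ (weightTo0 h) (allSeqs n))
      where
      step : ∀ s → weightTo0 (suc h) (down ∷ s) ≈ stepW κ ω L (suc h) down * weightTo0 h s
      step s with isPath L h s 0
      ... | true = refl
      ... | false = sym (zeroʳ _)

    firstStep-up : ∀ n h → h < L → firstStep up n h ≈ W n (suc h)
    firstStep-up n h h<L with h <ᵇ L | ℕ.<⇒<ᵇ h<L
    ... | true | _ = sumR-map-cong (allSeqs n) step
      where
      step : ∀ s → (if isPath L (suc h) s 0 then 1# * pathW κ ω L (suc h) s else 0#) ≈ weightTo0 (suc h) s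
      step s with isPath L (suc h) s 0
      ... | true = *-identityˡ _
      ... | false = refl

    firstStep-up-top : ∀ n → firstStep up n L ≈ 0#
    firstStep-up-top n with L <ᵇ L | ℕ.<ᵇ⇒< L L
    ... | false | _ = sumR-map-0 (allSeqs n)
    ... | true | L<L = contradiction (L<L tt) (ℕ.<-irrefl ≡.refl)

  W-suc-below : ∀ n h → h < L → W (suc n) h ≈ W n (suc h) + descend n h
  W-suc-below n h h<L = trans (W-suc-split n h) (+-cong (firstStep-up n h h<L) (firstStep-down n h))

  W-suc-top : ∀ n → W (suc n) L ≈ descend n L
  W-suc-top n = trans (W-suc-split n L) (trans (+-cong (firstStep-up-top n) (firstStep-down n L)) (+-identityˡ _))

module TransferSeries {c ℓ} (R : CommutativeRing c ℓ) (κ ω : CommutativeRing.Carrier R) where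

  open CommutativeRing R hiding (zero)
  open PowerSeries R
  private module S = CommutativeRing powerSeriesRing
  open IntegerCoefficients powerSeriesRing using (solve; _:=_; _:+_; _:*_; _:-_; _:^_; :1)
  private module ≋-Reasoning = SetoidReasoning S.setoid

  κ̂ ω̂ : Carrier
  κ̂ = κ - 1#
  ω̂ = ω - 1#

  Y A B C D M : Series
  Y = 𝟙 ⊕ X ^ 2
  A = X ^ 2 ⊖ const ω̂
  B = 𝟙 ⊖ const ω̂ ⊛ X ^ 2
  C = X ^ 2 ⊖ const κ̂
  D = 𝟙 ⊖ const κ̂ ⊛ X ^ 2
  M = X ^ 2 ⊖ 𝟙

  const≋const[a-1]⊕𝟙 : ∀ a → const a ≋ const (a - 1#) ⊕ 𝟙
  const≋const[a-1]⊕𝟙 a = S.trans (const-cong a≈a-1+1) (S.trans (const-+ (a - 1#) 1#) (S.+-congˡ const-1#))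
    where
    a≈a-1+1 : a ≈ a - 1# + 1#
    a≈a-1+1 = sym (trans (+-assoc _ _ _) (trans (+-congˡ (-‿inverseˡ 1#)) (+-identityʳ a)))

  -- the weight of a down step from height h + 1 < L
  downWeight : ℕ → Carrier
  downWeight zero = κ
  downWeight (suc _) = 1#

  recur : Series → Series → Series → Series
  recur w a b = Y ⊛ a ⊖ w ⊛ (X ^ 2 ⊛ b)

  recur-cong : ∀ {w w′ a a′ b b′} → w ≋ w′ → a ≋ a′ → b ≋ b′ → recur w a b ≋ recur w′ a′ b′
  recur-cong w≋w′ a≋a′ b≋b′ = S.+-cong (S.*-congˡ a≋a′) (S.-‿cong (S.*-cong w≋w′ (S.*-congˡ b≋b′)))

  recur-⊛ : ∀ m w a b → m ⊛ recur w a b ≋ recur w (m ⊛ a) (m ⊛ b)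
  recur-⊛ m w a b = solve 6 (λ m y x w a b →
    m :* (y :* a :- w :* (x :^ 2 :* b)) := y :* (m :* a) :- w :* (x :^ 2 :* (m :* b))) S.refl m Y X w a b

  Y⊛≋recur : ∀ w a b → Y ⊛ a ≋ recur w a b ⊕ w ⊛ (X ^ 2 ⊛ b)
  Y⊛≋recur w a b = solve 5 (λ y x w a b →
    y :* a := (y :* a :- w :* (x :^ 2 :* b)) :+ w :* (x :^ 2 :* b)) S.refl Y X w a b

  P : ℕ → Series
  P zero = 𝟙
  P (suc zero) = Y
  P (suc (suc h)) = recur (const (downWeight h)) (P (suc h)) (P h)

  M⊛P : ∀ h → M ⊛ P (suc h) ≋ C ⊛ (X ^ suc h) ^ 2 ⊖ D
  M⊛P zero = solve 2 (λ x k →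
    (x :^ 2 :- :1) :* (:1 :+ x :^ 2) := (x :^ 2 :- k) :* (x :^ 1) :^ 2 :- (:1 :- k :* x :^ 2)) S.refl X (const κ̂)
  M⊛P (suc zero) = begin
    M ⊛ recur (const κ) Y 𝟙                                        ≈⟨ recur-⊛ M (const κ) Y 𝟙 ⟩
    recur (const κ) (M ⊛ Y) (M ⊛ 𝟙)                                ≈⟨ recur-cong (const≋const[a-1]⊕𝟙 κ) (M⊛P zero) S.refl ⟩
    recur (const κ̂ ⊕ 𝟙) (C ⊛ (X ^ 1) ^ 2 ⊖ D) (M ⊛ 𝟙)              ≈⟨ solve 2 (λ x k →
      (:1 :+ x :^ 2) :* ((x :^ 2 :- k) :* (x :^ 1) :^ 2 :- (:1 :- k :* x :^ 2))
        :- (k :+ :1) :* (x :^ 2 :* ((x :^ 2 :- :1) :* :1))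
      := (x :^ 2 :- k) :* (x :^ 2) :^ 2 :- (:1 :- k :* x :^ 2)) S.refl X (const κ̂) ⟩
    C ⊛ (X ^ 2) ^ 2 ⊖ D                                            ∎
    where open ≋-Reasoning
  M⊛P (suc (suc h)) = begin
    M ⊛ recur (const 1#) (P (2 ℕ.+ h)) (P (suc h))                 ≈⟨ recur-⊛ M (const 1#) _ _ ⟩
    recur (const 1#) (M ⊛ P (2 ℕ.+ h)) (M ⊛ P (suc h))             ≈⟨ recur-cong const-1# (M⊛P (suc h)) (M⊛P h) ⟩
    recur 𝟙 (C ⊛ (X ⊛ p) ^ 2 ⊖ D) (C ⊛ p ^ 2 ⊖ D)                   ≈⟨ solve 3 (λ x k p →
      (:1 :+ x :^ 2) :* ((x :^ 2 :- k) :* (x :* p) :^ 2 :- (:1 :- k :* x :^ 2))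
        :- :1 :* (x :^ 2 :* ((x :^ 2 :- k) :* p :^ 2 :- (:1 :- k :* x :^ 2)))
      := (x :^ 2 :- k) :* (x :* (x :* p)) :^ 2 :- (:1 :- k :* x :^ 2)) S.refl X (const κ̂) p ⟩
    C ⊛ (X ^ (3 ℕ.+ h)) ^ 2 ⊖ D                                    ∎
    where
    open ≋-Reasoning
    p = X ^ suc h

  Y^suc⊛X^ : ∀ n a → Y ^ suc n ⊛ X ^ a ≋ Y ^ n ⊛ X ^ a ⊕ Y ^ n ⊛ X ^ (2 ℕ.+ a)
  Y^suc⊛X^ n a = solve 3 (λ x e p → (:1 :+ x :^ 2) :* e :* p := e :* p :+ e :* (x :* (x :* p))) S.refl X (Y ^ n) (X ^ a)

  -- Y ^ n = ρ^n (ρ + ρ⁻¹)^n is a palindrome of degree 2n.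
  Y^-palindromic : ∀ n a b → (Y ^ n ⊛ X ^ a) (n ℕ.+ b) ≈ (Y ^ n ⊛ X ^ b) (n ℕ.+ a)
  Y^-palindromic zero a b = trans (⊛-identityˡ _ b) (trans (X^-symmetric a b) (sym (⊛-identityˡ _ a)))
  Y^-palindromic (suc n) a b = begin
    (Y ^ suc n ⊛ X ^ a) (suc (n ℕ.+ b))                                       ≈⟨ Y^suc⊛X^ n a (suc (n ℕ.+ b)) ⟩
    (E ⊛ X ^ a) (suc (n ℕ.+ b)) + (E ⊛ X ^ (2 ℕ.+ a)) (suc (n ℕ.+ b))          ≈⟨ +-cong cross (cross′ a b) ⟩
    (E ⊛ X ^ (2 ℕ.+ b)) (suc (n ℕ.+ a)) + (E ⊛ X ^ b) (suc (n ℕ.+ a))          ≈⟨ +-comm _ _ ⟩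
    (E ⊛ X ^ b) (suc (n ℕ.+ a)) + (E ⊛ X ^ (2 ℕ.+ b)) (suc (n ℕ.+ a))          ≈⟨ Y^suc⊛X^ n b (suc (n ℕ.+ a)) ⟨
    (Y ^ suc n ⊛ X ^ b) (suc (n ℕ.+ a))                                       ∎
    where
    open SetoidReasoning setoid
    E = Y ^ n
    shifted : ∀ a b → (E ⊛ X ^ a) (suc (n ℕ.+ b)) ≈ (E ⊛ X ^ suc b) (n ℕ.+ a)
    shifted a b = trans (reindex (E ⊛ X ^ a) (≡.sym (ℕ.+-suc n b))) (Y^-palindromic n a (suc b))
    cross : (E ⊛ X ^ a) (suc (n ℕ.+ b)) ≈ (E ⊛ X ^ (2 ℕ.+ b)) (suc (n ℕ.+ a))
    cross = trans (shifted a b) (sym (⊛-X⊛-suc E (X ^ suc b) (n ℕ.+ a)))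
    cross′ : ∀ a b → (E ⊛ X ^ (2 ℕ.+ a)) (suc (n ℕ.+ b)) ≈ (E ⊛ X ^ b) (suc (n ℕ.+ a))
    cross′ a b = trans (shifted (2 ℕ.+ a) b)
      (trans (reindex (E ⊛ X ^ suc b) (≡.trans (ℕ.+-suc n (suc a)) (≡.cong suc (ℕ.+-suc n a))))
        (⊛-X⊛-suc E (X ^ b) (suc (n ℕ.+ a))))

  Y^⊛[X^k]²≈Y^ : ∀ n k → (Y ^ n ⊛ (X ^ k) ^ 2) (n ℕ.+ k) ≈ (Y ^ n) (n ℕ.+ k)
  Y^⊛[X^k]²≈Y^ n k = begin
    (E ⊛ (X ^ k ⊛ (X ^ k ⊛ 𝟙))) (n ℕ.+ k)   ≡⟨ ≡.cong (E ⊛ (X ^ k) ^ 2) (ℕ.+-comm n k) ⟩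
    (E ⊛ (X ^ k ⊛ (X ^ k ⊛ 𝟙))) (k ℕ.+ n)   ≈⟨ ⊛-X^⊛-+ E k (X ^ k ⊛ 𝟙) n ⟩
    (E ⊛ (X ^ k ⊛ 𝟙)) n                     ≈⟨ ⊛-cong {E} S.refl (S.*-identityʳ (X ^ k)) n ⟩
    (E ⊛ X ^ k) n                           ≡⟨ ≡.cong (E ⊛ X ^ k) (ℕ.+-identityʳ n) ⟨
    (E ⊛ X ^ k) (n ℕ.+ 0)                   ≈⟨ Y^-palindromic n k 0 ⟩
    (E ⊛ 𝟙) (n ℕ.+ k)                       ≈⟨ S.*-identityʳ E (n ℕ.+ k) ⟩
    E (n ℕ.+ k)                             ∎
    where
    open SetoidReasoning setoid
    E = Y ^ n

  Y^⊛[X^1+k]²≈Y^⊛X² : ∀ n k → (Y ^ n ⊛ (X ^ suc k) ^ 2) (n ℕ.+ suc (suc k)) ≈ (Y ^ n ⊛ X ^ 2) (n ℕ.+ suc (suc k))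
  Y^⊛[X^1+k]²≈Y^⊛X² n k = trans lhs (sym rhs)
    where
    open SetoidReasoning setoid
    E = Y ^ n
    lhs : (E ⊛ (X ^ suc k) ^ 2) (n ℕ.+ suc (suc k)) ≈ (E ⊛ X ^ k) n
    lhs = begin
      (E ⊛ (X ^ suc k ⊛ (X ^ suc k ⊛ 𝟙))) (n ℕ.+ suc (suc k))
        ≡⟨ ≡.cong (E ⊛ (X ^ suc k) ^ 2) (≡.trans (ℕ.+-comm n (suc (suc k))) (≡.sym (ℕ.+-suc (suc k) n))) ⟩
      (E ⊛ (X ^ suc k ⊛ (X ^ suc k ⊛ 𝟙))) (suc k ℕ.+ suc n) ≈⟨ ⊛-X^⊛-+ E (suc k) (X ^ suc k ⊛ 𝟙) (suc n) ⟩
      (E ⊛ (X ^ suc k ⊛ 𝟙)) (suc n)           ≈⟨ ⊛-cong {E} S.refl (S.*-identityʳ (X ^ suc k)) (suc n) ⟩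
      (E ⊛ (X ⊛ X ^ k)) (suc n)               ≈⟨ ⊛-X⊛-suc E (X ^ k) n ⟩
      (E ⊛ X ^ k) n                           ∎
    rhs : (E ⊛ X ^ 2) (n ℕ.+ suc (suc k)) ≈ (E ⊛ X ^ k) n
    rhs = begin
      (E ⊛ X ^ 2) (n ℕ.+ suc (suc k))         ≈⟨ Y^-palindromic n 2 (suc (suc k)) ⟩
      (E ⊛ (X ⊛ (X ⊛ X ^ k))) (n ℕ.+ 2)       ≡⟨ ≡.cong (E ⊛ X ^ suc (suc k)) (ℕ.+-comm n 2) ⟩
      (E ⊛ (X ⊛ (X ⊛ X ^ k))) (2 ℕ.+ n)       ≈⟨ ⊛-X⊛-suc E (X ⊛ X ^ k) (suc n) ⟩
      (E ⊛ (X ⊛ X ^ k)) (suc n)               ≈⟨ ⊛-X⊛-suc E (X ^ k) n ⟩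
      (E ⊛ X ^ k) n                           ∎

module Strip {c ℓ} (R : CommutativeRing c ℓ) (κ ω : CommutativeRing.Carrier R) (L′ : ℕ) where

  open CommutativeRing R hiding (zero)
  open PowerSeries R
  open TransferSeries R κ ω
  open WithRing R using (stepW)
  private
    module S = CommutativeRing powerSeriesRing
    module 𝒮 = IntegerCoefficients powerSeriesRing
    module ℛ = IntegerCoefficients R

  L : ℕ
  L = suc (suc L′)

  AB N Q T : Series
  AB = A ⊛ (X ^ L) ^ 2 ⊖ B
  N = (𝟙 ⊖ X ^ 2) ⊛ AB
  Q = A ⊛ C ⊛ (X ^ L) ^ 2 ⊖ B ⊛ D
  T = recur (const ω) (P L) (P (suc L′))

  a⊛N≋⊝[M⊛a⊛AB] : ∀ a → a ⊛ N ≋ ⊝ (M ⊛ a ⊛ AB)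
  a⊛N≋⊝[M⊛a⊛AB] a = solve 3 (λ a x ab → a :* ((:1 :- x :^ 2) :* ab) := :- ((x :^ 2 :- :1) :* a :* ab)) S.refl a X AB
    where open 𝒮

  P⊛N : ∀ h d → suc h ℕ.+ d ≡ L → ∃[ H ] P (suc h) ⊛ N ≋ Q ⊕ (X ^ suc h) ^ 2 ⊛ H
  P⊛N h d e = H , (begin
    P (suc h) ⊛ N                                ≈⟨ a⊛N≋⊝[M⊛a⊛AB] (P (suc h)) ⟩
    ⊝ (M ⊛ P (suc h) ⊛ AB)                       ≈⟨ S.-‿cong (S.*-cong (M⊛P h) (S.+-congʳ (S.*-congˡ X^L²≋))) ⟩
    ⊝ ((C ⊛ p ^ 2 ⊖ D) ⊛ (A ⊛ (p ⊛ q) ^ 2 ⊖ B))   ≈⟨ solve 6 (λ a b c d p q →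
      :- ((c :* p :^ 2 :- d) :* (a :* (p :* q) :^ 2 :- b))
      := a :* c :* (p :* q) :^ 2 :- b :* d
           :+ p :^ 2 :* (b :* c :+ (a :* d :- a :* c) :* q :^ 2 :- a :* c :* (p :* q) :^ 2)) S.refl A B C D p q ⟩
    A ⊛ C ⊛ (p ⊛ q) ^ 2 ⊖ B ⊛ D ⊕ p ^ 2 ⊛ H      ≈⟨ S.+-congʳ (S.+-congʳ (S.*-congˡ X^L²≋)) ⟨
    Q ⊕ p ^ 2 ⊛ H                                ∎)
    where
    open SetoidReasoning S.setoid
    open 𝒮
    p = X ^ suc h
    q = X ^ d
    H = B ⊛ C ⊕ (A ⊛ D ⊖ A ⊛ C) ⊛ q ^ 2 ⊖ A ⊛ C ⊛ (p ⊛ q) ^ 2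
    X^L²≋ : (X ^ L) ^ 2 ≋ (p ⊛ q) ^ 2
    X^L²≋ = S.*-cong X^L≋ (S.*-congʳ X^L≋)
      where
      X^L≋ : X ^ L ≋ p ⊛ q
      X^L≋ = S.trans (S.reflexive (≡.cong (X ^_) (≡.sym e))) (^-homo-* X (suc h) d)

  M⊛T : M ⊛ T ≋ Q
  M⊛T = begin
    M ⊛ recur (const ω) (P L) (P (suc L′))              ≈⟨ recur-⊛ M (const ω) _ _ ⟩
    recur (const ω) (M ⊛ P L) (M ⊛ P (suc L′))          ≈⟨ recur-cong (const≋const[a-1]⊕𝟙 ω) (M⊛P (suc L′)) (M⊛P L′) ⟩
    recur (const ω̂ ⊕ 𝟙) (C ⊛ (X ⊛ p) ^ 2 ⊖ D) (C ⊛ p ^ 2 ⊖ D) ≈⟨ solve 4 (λ x k w p →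
      (:1 :+ x :^ 2) :* ((x :^ 2 :- k) :* (x :* p) :^ 2 :- (:1 :- k :* x :^ 2))
        :- (w :+ :1) :* (x :^ 2 :* ((x :^ 2 :- k) :* p :^ 2 :- (:1 :- k :* x :^ 2)))
      := (x :^ 2 :- w) :* (x :^ 2 :- k) :* (x :* p) :^ 2 :- (:1 :- w :* x :^ 2) :* (:1 :- k :* x :^ 2))
      S.refl X (const κ̂) (const ω̂) p ⟩
    Q                                                   ∎
    where
    open SetoidReasoning S.setoid
    open 𝒮
    p = X ^ suc L′

  T⊛N : T ⊛ N ≋ ⊝ (Q ⊛ AB)
  T⊛N = S.trans (a⊛N≋⊝[M⊛a⊛AB] T) (S.-‿cong (S.*-congʳ M⊛T))

  Y^⊛AB-vanishes : ∀ n → (Y ^ n ⊛ AB) (n ℕ.+ suc L) ≈ 0#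
  Y^⊛AB-vanishes n = begin
    (E ⊛ AB) i
      ≈⟨ split i ⟩
    ((E ⊛ (X ^ suc L) ^ 2 ⊖ E) ⊖ const ω̂ ⊛ V) i
      ≈⟨ +-cong (x≈y⇒x∙y⁻¹≈ε (Y^⊛[X^k]²≈Y^ n (suc L))) (-‿cong (const-⊛ ω̂ V i)) ⟩
    0# - ω̂ * V i
      ≈⟨ +-congˡ (-‿cong (*-congˡ (x≈y⇒x∙y⁻¹≈ε (Y^⊛[X^1+k]²≈Y^⊛X² n (suc L′))))) ⟩
    0# - ω̂ * 0#
      ≈⟨ trans (+-identityˡ _) (trans (-‿cong (zeroʳ ω̂)) -0#≈0#) ⟩
    0# ∎
    where
    open SetoidReasoning setoid
    open import Algebra.Properties.Group +-group using (x≈y⇒x∙y⁻¹≈ε)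
    open import Algebra.Properties.Ring ring using (-0#≈0#)
    open 𝒮
    E = Y ^ n
    i = n ℕ.+ suc L
    V = E ⊛ (X ^ L) ^ 2 ⊖ E ⊛ X ^ 2
    split : E ⊛ AB ≋ (E ⊛ (X ^ suc L) ^ 2 ⊖ E) ⊖ const ω̂ ⊛ V
    split = solve 4 (λ e x w xl → e :* ((x :^ 2 :- w) :* xl :^ 2 :- (:1 :- w :* x :^ 2))
      := (e :* (x :* xl) :^ 2 :- e) :- w :* (e :* xl :^ 2 :- e :* x :^ 2)) S.refl E X (const ω̂) (X ^ L)

  -- Constant terms unfold to ring expressions in which every factor X contributes 0#.
  Q-0 : Q 0 ≈ - 1#
  Q-0 = solve 3 (λ w k t → (z :- w) :* (z :- k) :* ((:0 :* t) :* ((:0 :* t) :* :1)) :- (:1 :- w :* z) :* (:1 :- k :* z)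
                           := :- :1) refl ω̂ κ̂ ((X ^ suc L′) 0)
    where
    open ℛ
    z : ∀ {n} → Polynomial n
    z = :0 :* (:0 :* :1)

  N-0 : N 0 ≈ - 1#
  N-0 = solve 2 (λ w t → (:1 :- z) :* ((z :- w) :* ((:0 :* t) :* ((:0 :* t) :* :1)) :- (:1 :- w :* z))
                        := :- :1) refl ω̂ ((X ^ suc L′) 0)
    where
    open ℛ
    z : ∀ {n} → Polynomial n
    z = :0 :* (:0 :* :1)

  stepW-below : ∀ h → suc h < L → stepW κ ω L (suc h) down ≡ downWeight h
  stepW-below zero _ = ≡.refl
  stepW-below (suc h) (s≤s (s≤s h<L′)) with h ≡ᵇ L′ | ℕ.≡ᵇ⇒≡ h L′
  ... | false | _ = ≡.refl
  ... | true | h≡L′ = contradiction (h≡L′ _) (ℕ.<⇒≢ h<L′)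

  stepW-top : stepW κ ω L L down ≡ ω
  stepW-top with L′ ≡ᵇ L′ | ℕ.≡⇒≡ᵇ L′ L′ ≡.refl
  ... | true | _ = ≡.refl

  module WithInverse (Q⁻¹ : Series) (Q⊛Q⁻¹≋𝟙 : Q ⊛ Q⁻¹ ≋ 𝟙) where

    open PathWeights R κ ω L

    G : Series
    G = N ⊛ Q⁻¹

    Ψ : ℕ → ℕ → Carrier
    Ψ n h = (Y ^ n ⊛ (P h ⊛ G)) (n ℕ.+ h)

    P⊛G : ∀ h d → suc h ℕ.+ d ≡ L → ∃[ V ] P (suc h) ⊛ G ≋ 𝟙 ⊕ X ^ suc h ⊛ (X ^ suc h ⊛ V)
    P⊛G h d e = H ⊛ Q⁻¹ , (begin
      P (suc h) ⊛ (N ⊛ Q⁻¹)                   ≈⟨ S.*-assoc _ _ _ ⟨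
      P (suc h) ⊛ N ⊛ Q⁻¹                     ≈⟨ S.*-congʳ (proj₂ (P⊛N h d e)) ⟩
      (Q ⊕ p ^ 2 ⊛ H) ⊛ Q⁻¹                   ≈⟨ solve 4 (λ q p h q⁻¹ →
        (q :+ p :^ 2 :* h) :* q⁻¹ := q :* q⁻¹ :+ p :* (p :* (h :* q⁻¹))) S.refl Q p H Q⁻¹ ⟩
      Q ⊛ Q⁻¹ ⊕ p ⊛ (p ⊛ (H ⊛ Q⁻¹))            ≈⟨ S.+-congʳ Q⊛Q⁻¹≋𝟙 ⟩
      𝟙 ⊕ p ⊛ (p ⊛ (H ⊛ Q⁻¹))                 ∎)
      where
      open SetoidReasoning S.setoid
      open 𝒮
      p = X ^ suc h
      H = proj₁ (P⊛N h d e)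

    T⊛G : T ⊛ G ≋ ⊝ AB
    T⊛G = begin
      T ⊛ (N ⊛ Q⁻¹)         ≈⟨ S.*-assoc _ _ _ ⟨
      T ⊛ N ⊛ Q⁻¹           ≈⟨ S.*-congʳ T⊛N ⟩
      ⊝ (Q ⊛ AB) ⊛ Q⁻¹      ≈⟨ solve 3 (λ q ab q⁻¹ → :- (q :* ab) :* q⁻¹ := :- (ab :* (q :* q⁻¹))) S.refl Q AB Q⁻¹ ⟩
      ⊝ (AB ⊛ (Q ⊛ Q⁻¹))    ≈⟨ S.-‿cong (S.trans (S.*-congˡ Q⊛Q⁻¹≋𝟙) (S.*-identityʳ AB)) ⟩
      ⊝ AB                  ∎
      where
      open SetoidReasoning S.setoid
      open 𝒮

    Ψ-zero-zero : Ψ 0 0 ≈ 1#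
    Ψ-zero-zero = trans (*-identityˡ _) (trans (*-identityˡ _) G-0)
      where
      G-0 : G 0 ≈ 1#
      G-0 = trans (*-congʳ (trans N-0 (sym Q-0))) (Q⊛Q⁻¹≋𝟙 0)

    Ψ-zero-suc : ∀ h → suc h ≤ L → Ψ 0 (suc h) ≈ 0#
    Ψ-zero-suc h sh≤L = begin
      (𝟙 ⊛ (P (suc h) ⊛ G)) (suc h)
        ≈⟨ ⊛-cong {𝟙} S.refl (proj₂ P⊛G′) (suc h) ⟩
      (𝟙 ⊛ (𝟙 ⊕ p ⊛ (p ⊛ V))) (suc h)
        ≈⟨ ⊛-distribˡ 𝟙 𝟙 (p ⊛ (p ⊛ V)) (suc h) ⟩
      (𝟙 ⊛ 𝟙) (suc h) + (𝟙 ⊛ (p ⊛ (p ⊛ V))) (suc h)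
        ≈⟨ +-cong (⊛-identityˡ 𝟙 (suc h)) (reindex (𝟙 ⊛ (p ⊛ (p ⊛ V))) (≡.sym (ℕ.+-identityʳ (suc h)))) ⟩
      0# + (𝟙 ⊛ (p ⊛ (p ⊛ V))) (suc h ℕ.+ 0)
        ≈⟨ +-congˡ (⊛-X^⊛-+ 𝟙 (suc h) (p ⊛ V) 0) ⟩
      0# + 1# * ((X ⊛ X ^ h) 0 * V 0)
        ≈⟨ trans (+-identityˡ _) (trans (*-identityˡ _) (trans (*-congʳ (zeroˡ _)) (zeroˡ _))) ⟩
      0# ∎
      where
      open SetoidReasoning setoid
      P⊛G′ = P⊛G h (L ℕ.∸ suc h) (ℕ.m+[n∸m]≡n sh≤L)
      p = X ^ suc h
      V = proj₁ P⊛G′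

    Y-step : ∀ {a b d} w → Y ⊛ a ≋ b ⊕ const w ⊛ (X ^ 2 ⊛ d) → ∀ n i →
             (Y ^ suc n ⊛ (a ⊛ G)) (suc (suc i)) ≈ (Y ^ n ⊛ (b ⊛ G)) (suc (suc i)) + w * (Y ^ n ⊛ (d ⊛ G)) i
    Y-step {a} {b} {d} w Y⊛a≋ n i = begin
      (Y ^ suc n ⊛ (a ⊛ G)) (suc (suc i))
        ≈⟨ solve 4 (λ y e a g → y :* e :* (a :* g) := e :* (y :* a :* g)) S.refl Y E a G (suc (suc i)) ⟩
      (E ⊛ (Y ⊛ a ⊛ G)) (suc (suc i))
        ≈⟨ ⊛-cong {E} S.refl (S.*-congʳ Y⊛a≋) (suc (suc i)) ⟩
      (E ⊛ ((b ⊕ const w ⊛ (X ^ 2 ⊛ d)) ⊛ G)) (suc (suc i))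
        ≈⟨ solve 6 (λ e b w x d g → e :* ((b :+ w :* (x :^ 2 :* d)) :* g)
                                    := e :* (b :* g) :+ w :* (x :* (x :* (e :* (d :* g)))))
                   S.refl E b (const w) X d G (suc (suc i)) ⟩
      (E ⊛ (b ⊛ G)) (suc (suc i)) + (const w ⊛ (X ⊛ (X ⊛ V))) (suc (suc i))
        ≈⟨ +-congˡ (trans (const-⊛ w (X ⊛ (X ⊛ V)) (suc (suc i))) (*-congˡ X²⊛V)) ⟩
      (E ⊛ (b ⊛ G)) (suc (suc i)) + w * V i ∎
      where
      open SetoidReasoning setoid
      open 𝒮
      E = Y ^ n
      V = E ⊛ (d ⊛ G)
      X²⊛V : (X ⊛ (X ⊛ V)) (suc (suc i)) ≈ V i
      X²⊛V = trans (X⊛≋shift (X ⊛ V) (suc (suc i))) (X⊛≋shift V (suc i))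

    Ψ-suc-zero : ∀ n → Ψ (suc n) 0 ≈ Ψ n 1
    Ψ-suc-zero n = trans (solve 3 (λ y e g → y :* e :* (:1 :* g) := e :* (y :* g)) S.refl Y (Y ^ n) G (suc (n ℕ.+ 0)))
                         (reindex (Y ^ n ⊛ (Y ⊛ G)) (≡.sym (ℕ.+-suc n 0)))
      where open 𝒮

    Ψ-suc-below : ∀ n h → Ψ (suc n) (suc h) ≈ Ψ n (2 ℕ.+ h) + downWeight h * Ψ n h
    Ψ-suc-below n h = begin
      Ψ (suc n) (suc h)
        ≡⟨ ≡.cong (Y ^ suc n ⊛ (P (suc h) ⊛ G)) (≡.cong suc (ℕ.+-suc n h)) ⟩
      (Y ^ suc n ⊛ (P (suc h) ⊛ G)) (suc (suc (n ℕ.+ h)))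
        ≈⟨ Y-step (downWeight h) (Y⊛≋recur _ _ _) n (n ℕ.+ h) ⟩
      (Y ^ n ⊛ (P (2 ℕ.+ h) ⊛ G)) (2 ℕ.+ (n ℕ.+ h)) + downWeight h * Ψ n h
        ≡⟨ ≡.cong (λ i → (Y ^ n ⊛ (P (2 ℕ.+ h) ⊛ G)) i + downWeight h * Ψ n h) n+2+h ⟨
      Ψ n (2 ℕ.+ h) + downWeight h * Ψ n h ∎
      where
      open SetoidReasoning setoid
      n+2+h : n ℕ.+ suc (suc h) ≡ suc (suc (n ℕ.+ h))
      n+2+h = ≡.trans (ℕ.+-suc n (suc h)) (≡.cong suc (ℕ.+-suc n h))

    Ψ-suc-top : ∀ n → Ψ (suc n) L ≈ ω * Ψ n (suc L′)
    Ψ-suc-top n = begin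
      Ψ (suc n) L
        ≡⟨ ≡.cong (Y ^ suc n ⊛ (P L ⊛ G)) (≡.cong suc (ℕ.+-suc n (suc L′))) ⟩
      (Y ^ suc n ⊛ (P L ⊛ G)) (suc (suc (n ℕ.+ suc L′)))
        ≈⟨ Y-step ω (Y⊛≋recur _ _ _) n (n ℕ.+ suc L′) ⟩
      (E ⊛ (T ⊛ G)) i + ω * Ψ n (suc L′)
        ≈⟨ +-congʳ (⊛-cong {E} S.refl T⊛G i) ⟩
      (E ⊛ ⊝ AB) i + ω * Ψ n (suc L′)
        ≈⟨ +-congʳ (⊝-distribʳ-⊛ E AB i) ⟨
      - (E ⊛ AB) i + ω * Ψ n (suc L′)
        ≈⟨ +-congʳ (-‿cong (trans (reindex (E ⊛ AB) n+L+1) (Y^⊛AB-vanishes n))) ⟩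
      - 0# + ω * Ψ n (suc L′)
        ≈⟨ trans (+-congʳ -0#≈0#) (+-identityˡ _) ⟩
      ω * Ψ n (suc L′) ∎
      where
      open SetoidReasoning setoid
      open import Algebra.Properties.Ring ring using (-0#≈0#)
      open import Algebra.Properties.Ring S.ring using () renaming (-‿distribʳ-* to ⊝-distribʳ-⊛)
      E = Y ^ n
      i = suc (suc (n ℕ.+ suc L′))
      n+L+1 : i ≡ n ℕ.+ suc L
      n+L+1 = ≡.sym (≡.trans (ℕ.+-suc n L) (≡.cong suc (ℕ.+-suc n (suc L′))))

    Ψ≈W : ∀ n h → h ≤ L → Ψ n h ≈ W n h
    Ψ≈W zero zero _ = trans Ψ-zero-zero (sym W-zero-zero)
    Ψ≈W zero (suc h) sh≤L = trans (Ψ-zero-suc h sh≤L) (sym (W-zero-suc h))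
    Ψ≈W (suc n) zero _ = begin
      Ψ (suc n) 0             ≈⟨ Ψ-suc-zero n ⟩
      Ψ n 1                   ≈⟨ Ψ≈W n 1 (s≤s z≤n) ⟩
      W n 1                   ≈⟨ +-identityʳ _ ⟨
      W n 1 + descend n 0     ≈⟨ W-suc-below n 0 z<s ⟨
      W (suc n) 0             ∎
      where open SetoidReasoning setoid
    Ψ≈W (suc n) (suc h) sh≤L with ℕ.m≤n⇒m<n∨m≡n sh≤L
    ... | inj₁ sh<L = begin
      Ψ (suc n) (suc h)
        ≈⟨ Ψ-suc-below n h ⟩
      Ψ n (2 ℕ.+ h) + downWeight h * Ψ n h
        ≈⟨ +-cong (Ψ≈W n (2 ℕ.+ h) sh<L) (*-congˡ (Ψ≈W n h (ℕ.<⇒≤ (ℕ.<-trans (ℕ.n<1+n h) sh<L)))) ⟩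
      W n (2 ℕ.+ h) + downWeight h * W n h
        ≡⟨ ≡.cong (λ w → W n (2 ℕ.+ h) + w * W n h) (stepW-below h sh<L) ⟨
      W n (2 ℕ.+ h) + descend n (suc h)
        ≈⟨ W-suc-below n (suc h) sh<L ⟨
      W (suc n) (suc h) ∎
      where open SetoidReasoning setoid
    ... | inj₂ ≡.refl = begin
      Ψ (suc n) L
        ≈⟨ Ψ-suc-top n ⟩
      ω * Ψ n (suc L′)
        ≈⟨ *-congˡ (Ψ≈W n (suc L′) (ℕ.n≤1+n _)) ⟩
      ω * W n (suc L′)
        ≡⟨ ≡.cong (_* W n (suc L′)) stepW-top ⟨
      descend n L
        ≈⟨ W-suc-top n ⟨
      W (suc n) L ∎
      where open SetoidReasoning setoid

module ConstantTermIdentity {c ℓ} (R : CommutativeRing c ℓ) (κ ω : CommutativeRing.Carrier R) (L′ : ℕ) where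

  open CommutativeRing R hiding (zero)
  open WithRing R
  open PowerSeries R
  open LaurentExpansion R
  open TransferSeries R κ ω
  open Strip R κ ω L′
  private
    module S = CommutativeRing powerSeriesRing
    module 𝒮 = IntegerCoefficients powerSeriesRing

  Represents-ρ²-a : ∀ a → Represents (lsub (lpow lρ 2) (lconst a)) 0 (X ^ 2 ⊖ const a)
  Represents-ρ²-a a = Represents-cong ≡.refl (S.+-congʳ (⊛-identityˡ (X ^ 2)))
    (Represents-lsub-≤ z≤n (Represents-lρ^ 2) (Represents-lconst a))

  Represents-1-aρ² : ∀ a → Represents (lsub (lconst 1#) (lmul (lconst a) (lpow lρ 2))) 0 (𝟙 ⊖ const a ⊛ X ^ 2)
  Represents-1-aρ² a = Represents-cong ≡.refl (S.+-congʳ (S.trans (⊛-identityˡ (const 1#)) const-1#))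
    (Represents-lsub-≤ z≤n (Represents-lconst 1#) (Represents-lmul (Represents-lconst a) (Represents-lρ^ 2)))

  Represents-1-ρ² : Represents (lsub (lconst 1#) (lpow lρ 2)) 0 (𝟙 ⊖ X ^ 2)
  Represents-1-ρ² = Represents-cong ≡.refl (S.+-congʳ (S.trans (⊛-identityˡ (const 1#)) const-1#))
    (Represents-lsub-≤ z≤n (Represents-lconst 1#) (Represents-lρ^ 2))

  Represents-sρ^L-tρ^-L : ∀ {x y s t} → Represents x 0 s → Represents y 0 t →
    Represents (lsub (lmul x (lpow lρ L)) (lmul y (lpow lρ⁻¹ L))) L (s ⊛ (X ^ L) ^ 2 ⊖ t)
  Represents-sρ^L-tρ^-L {s = s} {t} x≈s y≈t = Represents-cong ≡.refl
    (solve 3 (λ p s t → p :* (s :* p) :- t :* :1 := s :* p :^ 2 :- t) S.refl (X ^ L) s t)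
    (Represents-lsub-≤ z≤n (Represents-lmul x≈s (Represents-lρ^ L)) (Represents-lmul y≈t (Represents-lρ⁻¹^ L)))
    where open 𝒮

  Represents-Den : Represents (Den κ ω L) L Q
  Represents-Den = Represents-sρ^L-tρ^-L
    (Represents-lmul (Represents-ρ²-a ω̂) (Represents-ρ²-a κ̂))
    (Represents-lmul (Represents-1-aρ² ω̂) (Represents-1-aρ² κ̂))

  Represents-ρ+ρ⁻¹ : Represents (ladd lρ lρ⁻¹) 1 Y
  Represents-ρ+ρ⁻¹ = Represents-cong ≡.refl
    (solve 1 (λ x → x :^ 1 :* x :+ :1 :* :1 := :1 :+ x :^ 2) S.refl X)
    (Represents-ladd Represents-lρ Represents-lρ⁻¹)
    where open 𝒮

  Represents-Num : ∀ r → Represents (Num κ ω L r) (L ℕ.+ (r ℕ.+ r)) (Y ^ (r ℕ.+ r) ⊛ N)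
  Represents-Num r = Represents-cong offset-≡ (S.*-assoc _ _ _)
    (Represents-lmul (Represents-lmul (Represents-lpow Represents-ρ+ρ⁻¹ (r ℕ.+ r)) Represents-1-ρ²)
                     (Represents-sρ^L-tρ^-L (Represents-ρ²-a ω̂) (Represents-1-aρ² ω̂)))
    where
    offset-≡ : (r ℕ.+ r) ℕ.* 1 ℕ.+ 0 ℕ.+ L ≡ L ℕ.+ (r ℕ.+ r)
    offset-≡ = ≡.trans (≡.cong (ℕ._+ L) (≡.trans (ℕ.+-identityʳ _) (ℕ.*-identityʳ _))) (ℕ.+-comm (r ℕ.+ r) L)

  Q⁻¹ : Series
  Q⁻¹ = inverse (proj₂ (Den κ ω L)) (- 1#)

  Den-coeff-0 : coeff (proj₂ (Den κ ω L)) 0 ≈ - 1#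
  Den-coeff-0 = trans (coefficients Represents-Den 0) Q-0

  -1*-1≈1 : - 1# * - 1# ≈ 1#
  -1*-1≈1 = trans (-1*x≈-x (- 1#)) (-‿involutive 1#)
    where open import Algebra.Properties.Ring ring using (-1*x≈-x; -‿involutive)

  -1*lowest-Den : - 1# * lowest (Den κ ω L) ≈ 1#
  -1*lowest-Den = trans (*-congˡ (trans (lowest≈coeff-0 (Den κ ω L)) Den-coeff-0)) -1*-1≈1

  Q⊛Q⁻¹ : Q ⊛ Q⁻¹ ≋ 𝟙
  Q⊛Q⁻¹ = S.trans (S.*-congʳ (S.sym (coefficients Represents-Den)))
    (⊛-inverse (proj₂ (Den κ ω L)) (- 1#) (trans (*-congʳ Den-coeff-0) -1*-1≈1))

  open WithInverse Q⁻¹ Q⊛Q⁻¹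
  open PathWeights R κ ω L using (W)

  Z≈CT : ∀ r → Z κ ω L (2 ℕ.* r) ≈ CT (Num κ ω L r) (Den κ ω L) (- 1#)
  Z≈CT r = begin
    W (r ℕ.+ (r ℕ.+ 0)) 0                 ≡⟨ ≡.cong (λ n → W n 0) (≡.cong (r ℕ.+_) (ℕ.+-identityʳ r)) ⟩
    W n 0                                 ≈⟨ Ψ≈W n 0 z≤n ⟨
    (Y ^ n ⊛ (𝟙 ⊛ G)) (n ℕ.+ 0)          ≡⟨ ≡.cong (Y ^ n ⊛ (𝟙 ⊛ G)) (ℕ.+-identityʳ n) ⟩
    (Y ^ n ⊛ (𝟙 ⊛ (N ⊛ Q⁻¹))) n          ≈⟨ solve 3 (λ y n q → y :* (:1 :* (n :* q)) := y :* n :* q) S.refl (Y ^ n) N Q⁻¹ n ⟩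
    (Y ^ n ⊛ N ⊛ Q⁻¹) n                  ≈⟨ CT-as-coefficient (- 1#) (Represents-Num r) (offset Represents-Den) ⟨
    CT (Num κ ω L r) (Den κ ω L) (- 1#)   ∎
    where
    open SetoidReasoning setoid
    open 𝒮
    n = r ℕ.+ r

theorem4 : ∀ {c ℓ} (R : CommutativeRing c ℓ) →
    let open CommutativeRing R
        open WithRing R
    in (L r : ℕ) → 2 ℕ.≤ L → (κ ω : Carrier) →
       ((- 1#) * lowest (Den κ ω L) ≈ 1#)
       × (Z κ ω L (2 ℕ.* r) ≈ CT (Num κ ω L r) (Den κ ω L) (- 1#))
theorem4 R (suc (suc L′)) r (s≤s (s≤s z≤n)) κ ω = -1*lowest-Den , Z≈CT r
  where open ConstantTermIdentity R κ ω L′
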